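{- Let $2 \le d \le b$ be integers and let $1/d = \sum_{i \geq 1} a_i b^{ -i}$ be the normal base-$b$ expansion of $1/d$ (digits $a_i \in \{0,\ldots,b-1\}$, not ending in infinitely many digits $b-1$). For every $k \geq 1$, we have $a_i = (b-d)^{i-1}$ for all $i = 1, \ldots, k$ if and only if $(b-d)^k < d$. (Here $0^0 = 1$.) -}

module Defs where

open import Data.Nat using (ℕ; _^_; _/_; _%_; _≤_; NonZero)

-- The i-th digit (i ≥ 1) of the normal (greedy) base-b expansion of 1/d:
--   a_i = ⌊ b^i · (1/d) ⌋ mod b = ⌊ b^i / d ⌋ mod b.
-- This is the unique expansion with digits in {0,…,b-1} not ending in
-- infinitely many digits b-1.
digit : (b d : ℕ) .{{_ : NonZero b}} .{{_ : NonZero d}} → ℕ → ℕ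
digit b d i = ((b ^ i) / d) % b

{-# OPTIONS --safe #-}
module Submission where

open import Defs
open import Data.Nat using (ℕ; suc; zero; _+_; _*_; _/_; _%_; _∸_; _^_; _≤_; _<_; NonZero; z≤n; s≤s)
open import Data.Nat.Properties
open import Data.Nat.DivMod
open import Data.Nat.Divisibility using (divides-refl)
open import Function.Bundles using (_⇔_; mk⇔; Equivalence)
open import Relation.Binary.PropositionalEquality
open ≡-Reasoning

-- Write c = b - d. Since b ≡ c (mod d), as long as c^j < d the remainder of b^j
-- modulo d is c^j itself, and one step of long division then yields the digit
-- a_{j+1} = ⌊b c^j / d⌋ = c^j + ⌊c^(j+1) / d⌋. So a_{j+1} = c^j exactly when
-- c^(j+1) < d, and since powers of c below d are downward closed, the first k
-- digits are the powers c^0, …, c^(k-1) exactly when c^k < d.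

[m+kn]/n≡m/n+k : ∀ m k n .{{_ : NonZero n}} → (m + k * n) / n ≡ m / n + k
[m+kn]/n≡m/n+k m k n =
  trans (+-distrib-/-∣ʳ m (divides-refl k)) (cong (m / n +_) (m*n/n≡m k n))

^-%-congˡ : ∀ {m n} d .{{_ : NonZero d}} → m % d ≡ n % d → ∀ j → m ^ j % d ≡ n ^ j % d
^-%-congˡ d m%d≡n%d zero = refl
^-%-congˡ {m} {n} d m%d≡n%d (suc j) = begin
  m * m ^ j % d                  ≡⟨ %-distribˡ-* m (m ^ j) d ⟩
  (m % d) * (m ^ j % d) % d      ≡⟨ cong₂ (λ x y → x * y % d) m%d≡n%d (^-%-congˡ d m%d≡n%d j) ⟩
  (n % d) * (n ^ j % d) % d      ≡⟨ %-distribˡ-* n (n ^ j) d ⟨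
  n * n ^ j % d                  ∎

-- Long division of m by d, one place further in base b: the next digit depends
-- only on the remainder m % d.
[b*m/d]%b≡b*[m%d]/d : ∀ b m d .{{_ : NonZero b}} .{{_ : NonZero d}} →
                      (b * m / d) % b ≡ b * (m % d) / d
[b*m/d]%b≡b*[m%d]/d b m d = begin
  b * m / d % b                  ≡⟨ cong (λ x → b * x / d % b) (m≡m%n+[m/n]*n m d) ⟩
  b * (r + q * d) / d % b        ≡⟨ cong (λ x → x / d % b) (*-distribˡ-+ b r (q * d)) ⟩
  (b * r + b * (q * d)) / d % b  ≡⟨ cong (λ x → (b * r + x) / d % b) (*-assoc b q d) ⟨
  (b * r + b * q * d) / d % b    ≡⟨ cong (_% b) ([m+kn]/n≡m/n+k (b * r) (b * q) d) ⟩
  (b * r / d + b * q) % b        ≡⟨ cong (λ x → (b * r / d + x) % b) (*-comm b q) ⟩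
  (b * r / d + q * b) % b        ≡⟨ [m+kn]%n≡m%n (b * r / d) q b ⟩
  b * r / d % b                  ≡⟨ m<n⇒m%n≡m (m<n*o⇒m/o<n (*-monoʳ-< b (m%n<n m d))) ⟩
  b * r / d                      ∎
  where
  r = m % d
  q = m / d

[c+d]*m/d≡m+c*m/d : ∀ c d m .{{_ : NonZero d}} → (c + d) * m / d ≡ m + c * m / d
[c+d]*m/d≡m+c*m/d c d m = begin
  (c + d) * m / d                ≡⟨ cong (_/ d) (*-distribʳ-+ m c d) ⟩
  (c * m + d * m) / d            ≡⟨ cong (λ x → (c * m + x) / d) (*-comm d m) ⟩
  (c * m + m * d) / d            ≡⟨ [m+kn]/n≡m/n+k (c * m) m d ⟩
  c * m / d + m                  ≡⟨ +-comm (c * m / d) m ⟩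
  m + c * m / d                  ∎

digit-suc : ∀ {b c d} .{{_ : NonZero b}} .{{_ : NonZero d}} → b ≡ c + d →
            ∀ j → c ^ j < d → digit b d (suc j) ≡ c ^ j + c ^ suc j / d
digit-suc {b} {c} {d} b≡c+d j cʲ<d = begin
  b * b ^ j / d % b              ≡⟨ [b*m/d]%b≡b*[m%d]/d b (b ^ j) d ⟩
  b * (b ^ j % d) / d            ≡⟨ cong (λ x → b * x / d) bʲ%d≡cʲ ⟩
  b * c ^ j / d                  ≡⟨ cong (λ x → x * c ^ j / d) b≡c+d ⟩
  (c + d) * c ^ j / d            ≡⟨ [c+d]*m/d≡m+c*m/d c d (c ^ j) ⟩
  c ^ j + c ^ suc j / d          ∎
  where
  b%d≡c%d : b % d ≡ c % d
  b%d≡c%d = trans (cong (_% d) b≡c+d) ([m+n]%n≡m%n c d)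
  bʲ%d≡cʲ : b ^ j % d ≡ c ^ j
  bʲ%d≡cʲ = trans (^-%-congˡ d b%d≡c%d j) (m<n⇒m%n≡m cʲ<d)

digit-suc≡^⇔ : ∀ {b c d} .{{_ : NonZero b}} .{{_ : NonZero d}} → b ≡ c + d →
               ∀ j → c ^ j < d → digit b d (suc j) ≡ c ^ j ⇔ c ^ suc j < d
digit-suc≡^⇔ {b} {c} {d} b≡c+d j cʲ<d = mk⇔
  (λ digit≡cʲ → m/n≡0⇒m<n (+-cancelˡ-≡ (c ^ j) _ 0 (begin
    c ^ j + c ^ suc j / d        ≡⟨ digit≡cʲ+cʲ⁺¹/d ⟨
    digit b d (suc j)            ≡⟨ digit≡cʲ ⟩
    c ^ j                        ≡⟨ +-identityʳ (c ^ j) ⟨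
    c ^ j + 0                    ∎)))
  (λ cʲ⁺¹<d → begin
    digit b d (suc j)            ≡⟨ digit≡cʲ+cʲ⁺¹/d ⟩
    c ^ j + c ^ suc j / d        ≡⟨ cong (c ^ j +_) (m<n⇒m/n≡0 cʲ⁺¹<d) ⟩
    c ^ j + 0                    ≡⟨ +-identityʳ (c ^ j) ⟩
    c ^ j                        ∎)
  where
  digit≡cʲ+cʲ⁺¹/d : digit b d (suc j) ≡ c ^ j + c ^ suc j / d
  digit≡cʲ+cʲ⁺¹/d = digit-suc b≡c+d j cʲ<d

-- For m = 0 the powers are not monotone (0⁰ = 1), whence the hypothesis 1 < n.
m^k<n⇒m^j<n : ∀ {m n j k} → 1 < n → j ≤ k → m ^ k < n → m ^ j < n
m^k<n⇒m^j<n {zero}  {j = zero}  1<n _   _      = 1<n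
m^k<n⇒m^j<n {zero}  {j = suc j} _   _   0ᵏ<n   = <-≤-trans (s≤s z≤n) 0ᵏ<n
m^k<n⇒m^j<n {suc m}             _   j≤k mᵏ<n   = ≤-<-trans (^-monoʳ-≤ (suc m) j≤k) mᵏ<n

lemma8p1 : (b d : ℕ) .{{_ : NonZero b}} .{{_ : NonZero d}} → 2 ≤ d → d ≤ b → (k : ℕ) → 1 ≤ k →
    ((∀ i → 1 ≤ i → i ≤ k → digit b d i ≡ (b ∸ d) ^ (i ∸ 1)) ⇔ ((b ∸ d) ^ k < d))
lemma8p1 b d 2≤d d≤b k _ = mk⇔ digits⇒bound bound⇒digits
  where
  c = b ∸ d
  b≡c+d : b ≡ c + d
  b≡c+d = sym (m∸n+n≡m d≤b)
  open Equivalence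

  digits⇒bound : (∀ i → 1 ≤ i → i ≤ k → digit b d i ≡ c ^ (i ∸ 1)) → c ^ k < d
  digits⇒bound digits = powers-below k ≤-refl
    where
    powers-below : ∀ j → j ≤ k → c ^ j < d
    powers-below zero    _     = 2≤d
    powers-below (suc j) 1+j≤k = to (digit-suc≡^⇔ b≡c+d j (powers-below j (<⇒≤ 1+j≤k)))
                                    (digits (suc j) (s≤s z≤n) 1+j≤k)

  bound⇒digits : c ^ k < d → ∀ i → 1 ≤ i → i ≤ k → digit b d i ≡ c ^ (i ∸ 1)
  bound⇒digits cᵏ<d (suc j) _ 1+j≤k =
    from (digit-suc≡^⇔ b≡c+d j (m^k<n⇒m^j<n 2≤d (<⇒≤ 1+j≤k) cᵏ<d))
         (m^k<n⇒m^j<n 2≤d 1+j≤k cᵏ<d)
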